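{- There is an absolute constant $C>0$ such that for every $n$-element poset $P=(S,\preceq)$ and every real $\gamma>0$, the total number of bits output by the procedure Flatten (described in the context) run on $P$ with parameter $\gamma$, i.e. the sum over all merge steps of $|L|\cdot|R|$ where $L,R$ are the lower and upper blocks merged in that step, is at most $C n^2/\gamma$.
   Context: Let $P=(S,\preceq)$ be a poset with $|S|=n$, and write $a\prec b$ for $a\preceq b$, $a\neq b$. The height of an element $a$ is the number of elements in a longest chain $a_1\prec a_2\prec\cdots\prec a_k=a$ ending at $a$ (so minimal elements have height 1). Let $U_h$ be the set of elements of height $h$, for $h=1,\dots,H$ where $H$ is the maximum height; each $U_h$ is an antichain. Procedure Flatten with parameter $\gamma>0$: maintain a list of blocks, initially $(U_1,\dots,U_H)$, and an index $i$, initially $1$. While $i$ is less than the current number of blocks, with current blocks denoted $(U_1,\dots,U_m)$: if $|U_i|+|U_{i+1}|\le 2n/\gamma$, perform a merge step: output a bit sequence of length $|U_i|\cdot|U_{i+1}|$ recording, for each pair $(x,y)\in U_i\times U_{i+1}$, whether $x\prec y$, and replace the two blocks $U_i,U_{i+1}$ by the single block $U_i\cup U_{i+1}$ (the later blocks are renumbered down by one; $i$ is unchanged); otherwise set $i\leftarrow i+1$.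
   Formalization: The parameter γ of Flatten ranges over the positive rationals instead of all positive reals. -}

module Defs where

open import Data.Nat using (ℕ; zero; suc; _+_; _*_; _≤_; _≤?_; _⊔_)
open import Data.Nat.Properties using (_≟_)
open import Data.Fin using (Fin)
open import Data.List using (List; []; _∷_; _++_; _∷ʳ_; length; map; filter; allFin; upTo; foldr)
open import Data.List.Relation.Unary.Linked using (Linked)
open import Data.Product using (Σ; _×_; ∃)
open import Relation.Binary.PropositionalEquality using (_≡_; _≢_)
open import Relation.Nullary using (yes; no)

Strict : {A : Set} → (A → A → Set) → A → A → Set
Strict _≼_ a b = (a ≼ b) × (a ≢ b)

ChainEndingAt : {A : Set} → (A → A → Set) → A → ℕ → Set
ChainEndingAt _≼_ a k =
  Σ _ λ xs → Linked (Strict _≼_) (xs ∷ʳ a) × (length (xs ∷ʳ a) ≡ k)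

IsHeight : {A : Set} → (A → A → Set) → A → ℕ → Set
IsHeight _≼_ a h =
  ChainEndingAt _≼_ a h × (∀ k → ChainEndingAt _≼_ a k → k ≤ h)

maxHeight : ∀ {n} → (Fin n → ℕ) → ℕ
maxHeight {n} ht = foldr _⊔_ 0 (map ht (allFin n))

heightLevels : ∀ {n} → (Fin n → ℕ) → List (List (Fin n))
heightLevels {n} ht =
  map (λ h → filter (λ a → ht a ≟ h) (allFin n)) (map suc (upTo (maxHeight ht)))

-- Total number of bits output by Flatten, with γ = p / q and threshold 2n/γ:
--   |U_i| + |U_{i+1}| ≤ 2n/γ   ⟺   (|U_i| + |U_{i+1}|) * p ≤ 2 * n * q.
-- The while loop is implemented with `cur` = the current block U_i and
-- `rest` = (U_{i+1}, …, U_m) (blocks before i are never touched again):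
--   merge step: output |U_i|·|U_{i+1}| bits, U_i := U_i ∪ U_{i+1}, i unchanged;
--   otherwise  : i := i + 1 (the next block becomes current).
flattenFrom : ∀ {A : Set} → (n p q : ℕ) → List A → List (List A) → ℕ
flattenFrom n p q cur [] = 0
flattenFrom n p q cur (B ∷ rest) with (length cur + length B) * p ≤? 2 * n * q
... | yes _ = length cur * length B + flattenFrom n p q (cur ++ B) rest
... | no  _ = flattenFrom n p q B rest

flattenBits : ∀ {A : Set} → (n p q : ℕ) → List (List A) → ℕ
flattenBits n p q [] = 0
flattenBits n p q (U₁ ∷ rest) = flattenFrom n p q U₁ rest

module Submission where

-- A merge step of Flatten only happens when the two blocks
-- L = U_i and R = U_{i+1} satisfy |L| + |R| ≤ 2n/γ, so it outputs
-- |L|·|R| ≤ (2n/γ)·|R| bits.  Every block R ever merged as an upper block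
-- is one of the original height levels U_2, …, U_H (the current block is the
-- only one that grows, and it is always the lower one), and each level is
-- the upper block of at most one merge.  Hence the total output is at most
-- (2n/γ) · Σ_h |U_h|, and the levels are disjoint subsets of the n
-- elements, so Σ_h |U_h| ≤ n.  This gives the bound with C = 2.
--
-- Neither step uses that
-- the order is a partial order or that `ht` is the height function: the
-- bound holds for the level decomposition of any key.

open import Defs
open import Data.Nat using (ℕ; suc; _*_; _+_; _≤_; _≤?_; z≤n)
open import Data.Nat.Properties
open import Algebra.Properties.CommutativeSemigroup +-commutativeSemigroup using (interchange)
import Algebra.Properties.CommutativeSemigroup *-commutativeSemigroup as *-Props
open import Data.Nat.ListAction using (sum)
open import Data.Fin using (Fin)
open import Data.Product using (∃; _,_)
open import Data.List using (List; []; _∷_; [_]; _++_; length; map; filter; allFin; upTo)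
open import Data.List.Properties using (filter-accept; filter-reject; length-tabulate)
open import Data.List.Relation.Unary.All using (All; []; _∷_)
open import Data.List.Relation.Unary.AllPairs using ([]; _∷_)
open import Data.List.Relation.Unary.Unique.Propositional using (Unique)
import Data.List.Relation.Unary.Unique.Propositional.Properties as Unique
open import Relation.Binary.PropositionalEquality using (_≡_; _≢_; refl; cong; cong₂; module ≡-Reasoning)
open import Relation.Binary.Structures using (IsPartialOrder)
open import Relation.Nullary using (yes; no)

totalSize : ∀ {A : Set} → List (List A) → ℕ
totalSize bs = sum (map length bs)

-- Charging one merge step: if (c + b)·p ≤ T, then the c·b bits of the step,
-- scaled by p, are at most T·b, i.e. the cost is charged to the upper block.
merge-cost : ∀ c b p T → (c + b) * p ≤ T → c * b * p ≤ T * b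
merge-cost c b p T cb≤T = begin
  c * b * p        ≡⟨ *-Props.xy∙z≈xz∙y c b p ⟩
  c * p * b        ≤⟨ *-monoˡ-≤ b (*-monoˡ-≤ p (m≤m+n c b)) ⟩
  (c + b) * p * b  ≤⟨ *-monoˡ-≤ b cb≤T ⟩
  T * b            ∎
  where open ≤-Reasoning

-- The loop of Flatten outputs (scaled by p) at most 2nq times the total size
-- of the blocks still to be visited: each of them is the upper block of at
-- most one merge, whose cost is charged to it by `merge-cost`.
flattenFrom-bound : ∀ {A : Set} (n p q : ℕ) (cur : List A) (bs : List (List A)) →
  flattenFrom n p q cur bs * p ≤ 2 * n * q * totalSize bs
flattenFrom-bound n p q cur [] = z≤n
flattenFrom-bound n p q cur (B ∷ rest) with (length cur + length B) * p ≤? 2 * n * q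
... | yes small = begin
    (length cur * length B + flattenFrom n p q (cur ++ B) rest) * p
      ≡⟨ *-distribʳ-+ p (length cur * length B) _ ⟩
    length cur * length B * p + flattenFrom n p q (cur ++ B) rest * p
      ≤⟨ +-mono-≤ (merge-cost (length cur) (length B) p (2 * n * q) small)
                  (flattenFrom-bound n p q (cur ++ B) rest) ⟩
    2 * n * q * length B + 2 * n * q * totalSize rest
      ≡⟨ *-distribˡ-+ (2 * n * q) (length B) (totalSize rest) ⟨
    2 * n * q * totalSize (B ∷ rest) ∎
  where open ≤-Reasoning
... | no _ = ≤-trans (flattenFrom-bound n p q B rest)
                     (*-monoʳ-≤ (2 * n * q) (m≤n+m (totalSize rest) (length B)))

-- The whole procedure: the first block is never an upper block, so the
-- output is bounded by 2nq times the total size of all blocks.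
flattenBits-bound : ∀ {A : Set} (n p q : ℕ) (bs : List (List A)) →
  flattenBits n p q bs * p ≤ 2 * n * q * totalSize bs
flattenBits-bound n p q [] = z≤n
flattenBits-bound n p q (U ∷ rest) =
  ≤-trans (flattenFrom-bound n p q U rest)
          (*-monoʳ-≤ (2 * n * q) (m≤n+m (totalSize rest) (length U)))

module Levels {A : Set} (key : A → ℕ) where

  level : ℕ → List A → List A
  level h = filter (λ a → key a ≟ h)

  levelsSize : List ℕ → List A → ℕ
  levelsSize hs xs = totalSize (map (λ h → level h xs) hs)

  level-∷ : ∀ h a xs → length (level h (a ∷ xs)) ≡ length (level h [ a ]) + length (level h xs)
  level-∷ h a xs with key a ≟ h
  ... | yes a∈h rewrite filter-accept (λ x → key x ≟ h) {a} {xs} a∈h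
                      | filter-accept (λ x → key x ≟ h) {a} {[]} a∈h = refl
  ... | no  a∉h rewrite filter-reject (λ x → key x ≟ h) {a} {xs} a∉h
                      | filter-reject (λ x → key x ≟ h) {a} {[]} a∉h = refl

  levelsSize-∷ : ∀ hs a xs → levelsSize hs (a ∷ xs) ≡ levelsSize hs [ a ] + levelsSize hs xs
  levelsSize-∷ []       a xs = refl
  levelsSize-∷ (h ∷ hs) a xs = begin
    length (level h (a ∷ xs)) + levelsSize hs (a ∷ xs)
      ≡⟨ cong₂ _+_ (level-∷ h a xs) (levelsSize-∷ hs a xs) ⟩
    (length (level h [ a ]) + length (level h xs)) + (levelsSize hs [ a ] + levelsSize hs xs)
      ≡⟨ interchange (length (level h [ a ])) (length (level h xs)) _ _ ⟩
    levelsSize (h ∷ hs) [ a ] + levelsSize (h ∷ hs) xs ∎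
    where open ≡-Reasoning

  levelsSize-avoid : ∀ a hs → All (key a ≢_) hs → levelsSize hs [ a ] ≡ 0
  levelsSize-avoid a []       []         = refl
  levelsSize-avoid a (h ∷ hs) (a≢h ∷ ne) rewrite filter-reject (λ x → key x ≟ h) {a} {[]} a≢h =
    levelsSize-avoid a hs ne

  levelsSize-single : ∀ a hs → Unique hs → levelsSize hs [ a ] ≤ 1
  levelsSize-single a []       []          = z≤n
  levelsSize-single a (h ∷ hs) (h∉hs ∷ u) with key a ≟ h
  ... | yes refl rewrite filter-accept (λ x → key x ≟ key a) {a} {[]} refl =
    ≤-reflexive (cong suc (levelsSize-avoid a hs h∉hs))
  ... | no  a∉h rewrite filter-reject (λ x → key x ≟ h) {a} {[]} a∉h =
    levelsSize-single a hs u

  levelsSize-≤ : ∀ hs xs → Unique hs → levelsSize hs xs ≤ length xs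
  levelsSize-≤ hs []       u = ≤-reflexive (levelsSize-[] hs)
    where
    levelsSize-[] : ∀ hs → levelsSize hs [] ≡ 0
    levelsSize-[] []       = refl
    levelsSize-[] (_ ∷ hs) = levelsSize-[] hs
  levelsSize-≤ hs (a ∷ xs) u rewrite levelsSize-∷ hs a xs =
    +-mono-≤ (levelsSize-single a hs u) (levelsSize-≤ hs xs u)

heightLevels-size : ∀ {n} (ht : Fin n → ℕ) → totalSize (heightLevels ht) ≤ n
heightLevels-size {n} ht = begin
  Levels.levelsSize ht heights (allFin n) ≤⟨ Levels.levelsSize-≤ ht heights (allFin n) distinct ⟩
  length (allFin n)                       ≡⟨ length-tabulate (λ i → i) ⟩
  n                                       ∎
  where
  open ≤-Reasoning
  heights : List ℕ
  heights = map suc (upTo (maxHeight ht))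
  distinct : Unique heights
  distinct = Unique.map⁺ suc-injective (Unique.upTo⁺ (maxHeight ht))

lemma2 : ∃ λ (C : ℕ) →
    (n : ℕ) (_≼_ : Fin n → Fin n → Set) → IsPartialOrder _≡_ _≼_ →
    (ht : Fin n → ℕ) → (∀ a → IsHeight _≼_ a (ht a)) →
    (p q : ℕ) → 1 ≤ p → 1 ≤ q →
    flattenBits n p q (heightLevels ht) * p ≤ C * (n * n) * q
lemma2 = 2 , λ n _ _ ht _ p q _ _ → begin
  flattenBits n p q (heightLevels ht) * p ≤⟨ flattenBits-bound n p q (heightLevels ht) ⟩
  2 * n * q * totalSize (heightLevels ht) ≤⟨ *-monoʳ-≤ (2 * n * q) (heightLevels-size ht) ⟩
  2 * n * q * n                           ≡⟨ *-Props.xy∙z≈xz∙y (2 * n) q n ⟩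
  2 * n * n * q                           ≡⟨ cong (_* q) (*-assoc 2 n n) ⟩
  2 * (n * n) * q                         ∎
  where open ≤-Reasoning
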